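{- Let $n\ge 5$. The graph $C^2_n$ is $W_6$-minor-free if and only if $5\le n\le 8$.
   Context: All graphs are finite and simple. For $n\geq 5$, $C^2_n$ is the graph obtained from the cycle $C_n$ by adding edges between all pairs of vertices at distance two on the cycle (it is $4$-connected). A graph is $W_6$-minor-free if no minor of it (obtained by edge deletions and edge contractions) is isomorphic to $W_6$, the wheel obtained by joining a new vertex to all vertices of a $6$-cycle. -}

module Defs where

open import Data.Nat using (ℕ; zero; suc; _+_; _%_; _≡ᵇ_)
open import Data.Fin using (Fin; toℕ; _≟_)
open import Data.Bool using (Bool; true; false; not; _∧_; _∨_)
open import Data.Bool.Properties using (∨-comm)
open import Data.Product using (Σ; ∃; ∃-syntax; _×_; _,_)
open import Data.Sum using (_⊎_)
open import Relation.Nullary using (¬_; yes; no)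
open import Relation.Nullary.Decidable using (⌊_⌋)
open import Relation.Binary.PropositionalEquality using (_≡_; _≢_; refl; sym; cong₂)
open import Function.Bundles using (_↔_; _⇔_; Inverse)

record Graph : Set where
  field
    size       : ℕ
    adj        : Fin size → Fin size → Bool
    adj-sym    : ∀ x y → adj x y ≡ adj y x
    adj-irrefl : ∀ x → adj x x ≡ false
open Graph public

_==_ : ∀ {n} → Fin n → Fin n → Bool
x == y = ⌊ x ≟ y ⌋

==-sym : ∀ {n} (x y : Fin n) → (x == y) ≡ (y == x)
==-sym x y with x ≟ y | y ≟ x
... | yes _  | yes _  = refl
... | no _   | no _   = refl
... | yes p  | no ¬q  with ¬q (sym p)
...   | ()
==-sym x y | no ¬p | yes q with ¬p (sym q)
...   | ()

==-refl : ∀ {n} (x : Fin n) → (x == x) ≡ true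
==-refl x with x ≟ x
... | yes _ = refl
... | no ¬p with ¬p refl
...   | ()

mkGraph : (n : ℕ) → (Fin n → Fin n → Bool) → Graph
mkGraph n R = record
  { size       = n
  ; adj        = λ x y → not (x == y) ∧ (R x y ∨ R y x)
  ; adj-sym    = λ x y → cong₂ (λ a b → not a ∧ b) (==-sym x y) (∨-comm (R x y) (R y x))
  ; adj-irrefl = λ x → cong₂ (λ a b → not a ∧ b) (==-refl x) refl
  }

record _≅_ (H G : Graph) : Set where
  field
    bij      : Fin (size H) ↔ Fin (size G)
    preserve : ∀ x y → adj H x y ≡ adj G (Inverse.to bij x) (Inverse.to bij y)

deleteEdge : (G : Graph) → Fin (size G) → Fin (size G) → Graph
deleteEdge G u v = mkGraph (size G) (λ x y →
  adj G x y ∧ not ((x == u ∧ y == v) ∨ (x == v ∧ y == u)))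

-- G' is (isomorphic to) the graph obtained from G by contracting the edge uv:
-- f : V(G) → V(G') is surjective, identifies exactly u and v, and two
-- distinct vertices of G' are adjacent iff some edge of G joins their preimages.

record Contraction (G : Graph) (u v : Fin (size G)) (G' : Graph) : Set where
  field
    edge   : adj G u v ≡ true
    f      : Fin (size G) → Fin (size G')
    surj   : ∀ a → ∃[ x ] f x ≡ a
    merge  : f u ≡ f v
    fibres : ∀ x y → f x ≡ f y → x ≡ y ⊎ ((x ≡ u × y ≡ v) ⊎ (x ≡ v × y ≡ u))
    adj'   : ∀ a b → (adj G' a b ≡ true) ⇔
               (a ≢ b × ∃[ x ] ∃[ y ] (f x ≡ a × f y ≡ b × adj G x y ≡ true))

-- H ≼ G : H is a minor of G, i.e. (a graph isomorphic to) H is obtained from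
-- G by a finite sequence of edge deletions and edge contractions.

data _≼_ (H : Graph) : Graph → Set where
  iso : ∀ {G} → H ≅ G → H ≼ G
  del : ∀ {G} (u v : Fin (size G)) → adj G u v ≡ true →
        H ≼ deleteEdge G u v → H ≼ G
  con : ∀ {G G'} (u v : Fin (size G)) → Contraction G u v G' →
        H ≼ G' → H ≼ G

-- C²_n on vertices Fin n = {0,…,n-1} (cycle order): i ~ j iff i ≠ j and
-- j ≡ i+1 or i+2 (mod n), or vice versa.

C² : ℕ → Graph
C² zero    = mkGraph zero (λ _ _ → false)
C² (suc m) = mkGraph (suc m) (λ i j →
  (toℕ j ≡ᵇ (toℕ i + 1) % suc m) ∨ (toℕ j ≡ᵇ (toℕ i + 2) % suc m))

-- W₆ on Fin 7: centre 0 adjacent to all of 1..6; rim cycle 1-2-3-4-5-6-1.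

W₆ : Graph
W₆ = mkGraph 7 (λ i j → (toℕ i ≡ᵇ 0) ∨ (toℕ j ≡ᵇ suc (toℕ i % 6)))

MinorFree : Graph → Graph → Set
MinorFree H G = ¬ (H ≼ G)

{-# OPTIONS --safe #-}
-- Deleting an edge never raises a degree, and contracting an edge uv removes one vertex and
-- creates one of degree |N(u) ∪ N(v) ∖ {u, v}|.  So if G has at most 8 vertices, maximum degree
-- at most 5, and |N(u) ∪ N(v) ∖ {u, v}| ≤ 5 for every edge uv, then any minor obtained with one
-- contraction still has maximum degree at most 5, and one with two contractions has at most 6
-- vertices; either way it is not W₆, which has 7 vertices and a vertex of degree 6.  The graphs
-- C²_n with n ≤ 8 satisfy these bounds.  Conversely W₆ is a minor of C²_9, and contracting the
-- edge {n-1, n} of C²_{n+1}, or of C²_{n+1} minus the edge {n-1, 0}, yields C²_n minus the edge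
-- {n-2, 0}; by induction W₆ is a minor of C²_n for every n ≥ 9.
module Submission where

open import Defs
open import Data.Empty using (⊥; ⊥-elim)
open import Data.Nat using (ℕ; zero; suc; _+_; _≤_; _<_; z≤n; s≤s; _≤?_; _≡ᵇ_; _%_)
open import Data.Nat.Properties
  using (≤-trans; ≤-pred; <⇒≱; <⇒≤; <-≤-trans; ≮⇒≥; n≤1+n; 1+n≰n; 1+n≢n; m≤n⇒m<n∨m≡n;
         m≤n⇒∃[o]m+o≡n; +-comm; ≡ᵇ⇒≡; ≡⇒≡ᵇ)
  renaming (_≟_ to _≟ℕ_)
open import Data.Nat.DivMod using (n%n≡0; [m+n]%n≡m%n; m<n⇒m%n≡m)
open import Data.Fin as Fin using (Fin; zero; suc; toℕ; fromℕ; inject₁; pinch; #_; _≟_)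
open import Data.Fin.Properties
  using (injective⇒≤; all?; any?; suc-injective; toℕ<n; toℕ-injective; toℕ-fromℕ; toℕ-inject₁;
         pinch-surjective)
open import Data.Bool using (Bool; true; false; T; not; _∧_; _∨_)
import Data.Bool.Properties as Bool
open import Data.Bool.ListAction using (any)
open import Data.Product using (Σ-syntax; ∃-syntax; _×_; _,_; proj₁; proj₂)
import Data.Product as Product
open import Data.Product.Function.NonDependent.Propositional using (_×-⇔_)
open import Data.Sum using (_⊎_; inj₁; inj₂)
import Data.Sum as Sum
open import Data.Sum.Function.Propositional using (_⊎-⇔_)
open import Data.List using (List; []; _∷_; length; filter; allFin)
import Data.List as List
open import Data.List.Membership.Propositional using (_∈_)
open import Data.List.Membership.Propositional.Properties using (∈-filter⁺; ∈-allFin)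
open import Data.List.Relation.Unary.Any using (index)
open import Data.List.Relation.Unary.Any.Properties using (lookup-index)
open import Data.Vec using (_∷_; []; lookup)
open import Relation.Nullary using (¬_; Dec; yes; no; ¬?)
open import Relation.Nullary.Decidable
  using (⌊_⌋; _×-dec_; _⊎-dec_; _→-dec_; True; toWitness; fromWitness; map′)
open import Relation.Nullary.Negation using (contradiction)
open import Relation.Unary using (Decidable)
open import Relation.Binary.PropositionalEquality
  using (_≡_; _≢_; refl; sym; trans; cong; subst; module ≡-Reasoning)
open import Function.Base using (_∘_)
open import Function.Bundles using (_⇔_; mk⇔; Inverse; Injection; Equivalence)
open import Function.Construct.Composition using (_⇔-∘_)
open import Function.Construct.Identity using (⇔-id; ↔-id)
open import Function.Construct.Symmetry using (⇔-sym)
open import Function.Definitions using (Injective)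
open import Function.Properties.Inverse using (↔⇒↣)
adj-mkGraph : ∀ {n} (R : Fin n → Fin n → Bool) (x y : Fin n) →
              adj (mkGraph n R) x y ≡ true ⇔ (x ≢ y × (R x y ≡ true ⊎ R y x ≡ true))
adj-mkGraph R x y with x ≟ y | R x y | R y x
... | yes x≡y | _     | _     = mk⇔ (λ ()) (λ (x≢y , _) → contradiction x≡y x≢y)
... | no x≢y  | true  | _     = mk⇔ (λ _ → x≢y , inj₁ refl) (λ _ → refl)
... | no x≢y  | false | true  = mk⇔ (λ _ → x≢y , inj₂ refl) (λ _ → refl)
... | no x≢y  | false | false = mk⇔ (λ ()) (λ { (_ , inj₁ ()) ; (_ , inj₂ ()) })

adj⇒≢ : (G : Graph) {x y : Fin (size G)} → adj G x y ≡ true → x ≢ y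
adj⇒≢ G {x} xy refl with trans (sym xy) (adj-irrefl G x)
... | ()

adj-deleteEdge⇒adj : (G : Graph) (u v x y : Fin (size G)) →
                     adj (deleteEdge G u v) x y ≡ true → adj G x y ≡ true
adj-deleteEdge⇒adj G u v x y xy with proj₂ (Equivalence.to (adj-mkGraph kept x y) xy)
  where kept = λ x y → adj G x y ∧ not ((x == u ∧ y == v) ∨ (x == v ∧ y == u))
... | inj₁ kept-xy = Bool.∧-conicalˡ _ _ kept-xy
... | inj₂ kept-yx = trans (adj-sym G x y) (Bool.∧-conicalˡ _ _ kept-yx)

⌊⌋⇔ : ∀ {A : Set} (a? : Dec A) → ⌊ a? ⌋ ≡ true ⇔ A
⌊⌋⇔ a? = mk⇔ (toWitness ∘ Equivalence.from Bool.T-≡) (Equivalence.to Bool.T-≡ ∘ fromWitness)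

adj-mkGraph-dec : ∀ {n} {P : Fin n → Fin n → Set} (P? : ∀ x y → Dec (P x y)) (i j : Fin n) →
                  adj (mkGraph n (λ x y → ⌊ P? x y ⌋)) i j ≡ true ⇔ (i ≢ j × (P i j ⊎ P j i))
adj-mkGraph-dec P? i j =
  (⇔-id _ ×-⇔ (⌊⌋⇔ (P? i j) ⊎-⇔ ⌊⌋⇔ (P? j i))) ⇔-∘ adj-mkGraph (λ x y → ⌊ P? x y ⌋) i j

AtLeast : ∀ {n} → ℕ → (Fin n → Set) → Set
AtLeast {n} k P = Σ[ g ∈ (Fin k → Fin n) ] Injective _≡_ _≡_ g × (∀ i → P (g i))

AtLeast-mono : ∀ {n k} {P Q : Fin n → Set} → (∀ {x} → P x → Q x) → AtLeast k P → AtLeast k Q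
AtLeast-mono P⇒Q (g , g-inj , Pg) = g , g-inj , P⇒Q ∘ Pg

count : ∀ {n} {P : Fin n → Set} → Decidable P → ℕ
count {n} P? = length (filter P? (allFin n))

AtLeast⇒≤count : ∀ {n k} {P : Fin n → Set} (P? : Decidable P) → AtLeast k P → k ≤ count P?
AtLeast⇒≤count {n} P? (g , g-inj , Pg) = injective⇒≤ index-injective
  where
  open ≡-Reasoning
  witnesses = filter P? (allFin n)
  g∈ : ∀ i → g i ∈ witnesses
  g∈ i = ∈-filter⁺ P? (∈-allFin (g i)) (Pg i)
  index-injective : Injective _≡_ _≡_ (index ∘ g∈)
  index-injective {i} {j} e = g-inj (begin
    g i                                  ≡⟨ lookup-index (g∈ i) ⟩
    List.lookup witnesses (index (g∈ i)) ≡⟨ cong (List.lookup witnesses) e ⟩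
    List.lookup witnesses (index (g∈ j)) ≡⟨ sym (lookup-index (g∈ j)) ⟩
    g j                                  ∎)

count≤⇒¬AtLeast : ∀ {n k} {P : Fin n → Set} (P? : Decidable P) →
                  count P? ≤ k → ¬ AtLeast (suc k) P
count≤⇒¬AtLeast P? c≤k atLeast = 1+n≰n (≤-trans (AtLeast⇒≤count P? atLeast) c≤k)

MaxDegree≤ : ℕ → Graph → Set
MaxDegree≤ k G = ∀ x → ¬ AtLeast (suc k) (λ y → adj G x y ≡ true)

EdgeNeighbour : (G : Graph) → Fin (size G) → Fin (size G) → Fin (size G) → Set
EdgeNeighbour G u v y = y ≢ u × y ≢ v × (adj G u y ≡ true ⊎ adj G v y ≡ true)

-- Contracting the edge uv creates a vertex whose neighbours are the EdgeNeighbours of uv.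
MaxEdgeDegree≤ : ℕ → Graph → Set
MaxEdgeDegree≤ k G = ∀ u v → adj G u v ≡ true → ¬ AtLeast (suc k) (EdgeNeighbour G u v)

adjacent? : (G : Graph) (x : Fin (size G)) → Decidable (λ y → adj G x y ≡ true)
adjacent? G x y = adj G x y Bool.≟ true

edgeNeighbour? : (G : Graph) (u v : Fin (size G)) → Decidable (EdgeNeighbour G u v)
edgeNeighbour? G u v y = ¬? (y ≟ u) ×-dec ¬? (y ≟ v) ×-dec (adjacent? G u y ⊎-dec adjacent? G v y)

maxDegree≤-by-count : ∀ k G → (∀ x → count (adjacent? G x) ≤ k) → MaxDegree≤ k G
maxDegree≤-by-count k G bound x = count≤⇒¬AtLeast (adjacent? G x) (bound x)

maxEdgeDegree≤-by-count : ∀ k G → (∀ u v → adj G u v ≡ true → count (edgeNeighbour? G u v) ≤ k) →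
                          MaxEdgeDegree≤ k G
maxEdgeDegree≤-by-count k G bound u v uv = count≤⇒¬AtLeast (edgeNeighbour? G u v) (bound u v uv)

MaxDegree≤-deleteEdge : ∀ {k} G {u v} → MaxDegree≤ k G → MaxDegree≤ k (deleteEdge G u v)
MaxDegree≤-deleteEdge G {u} {v} deg x = deg x ∘ AtLeast-mono (λ {y} → adj-deleteEdge⇒adj G u v x y)

MaxEdgeDegree≤-deleteEdge : ∀ {k} G {u v} → MaxEdgeDegree≤ k G → MaxEdgeDegree≤ k (deleteEdge G u v)
MaxEdgeDegree≤-deleteEdge G {u} {v} edgeDeg a b ab =
  edgeDeg a b (⊆G a b ab) ∘ AtLeast-mono (λ {y} → weaken {y})
  where
  ⊆G = adj-deleteEdge⇒adj G u v
  weaken : ∀ {y} → EdgeNeighbour (deleteEdge G u v) a b y → EdgeNeighbour G a b y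
  weaken {y} (y≢a , y≢b , ay⊎by) = y≢a , y≢b , Sum.map (⊆G a y) (⊆G b y) ay⊎by

module _ {G G' : Graph} {u v : Fin (size G)} (c : Contraction G u v G') where
  open Contraction c

  fibre-injective : ∀ {x y} → f x ≡ f y → f x ≢ f u → x ≡ y
  fibre-injective fx≡fy fx≢fu with fibres _ _ fx≡fy
  ... | inj₁ x≡y               = x≡y
  ... | inj₂ (inj₁ (refl , _)) = contradiction refl fx≢fu
  ... | inj₂ (inj₂ (refl , _)) = contradiction (sym merge) fx≢fu

  merged-fibre : ∀ {x} → f x ≡ f u → x ≡ u ⊎ x ≡ v
  merged-fibre fx≡fu with fibres _ u fx≡fu
  ... | inj₁ x≡u               = inj₁ x≡u
  ... | inj₂ (inj₁ (x≡u , _))  = inj₁ x≡u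
  ... | inj₂ (inj₂ (x≡v , _))  = inj₂ x≡v

  contraction-shrinks : size G' < size G
  contraction-shrinks = injective⇒≤ extend-injective
    where
    s : Fin (size G') → Fin (size G)
    s a = proj₁ (surj a)
    f∘s : ∀ a → f (s a) ≡ a
    f∘s a = proj₂ (surj a)
    s-injective : Injective _≡_ _≡_ s
    s-injective {a} {b} e = trans (sym (f∘s a)) (trans (cong f e) (f∘s b))
    -- u ≢ v, so one of them is missed by the section s.
    spare : ∃[ w ] f w ≡ f u × w ≢ s (f u)
    spare with s (f u) ≟ u
    ... | yes su≡u = v , sym merge , λ v≡su → adj⇒≢ G edge (trans (sym su≡u) (sym v≡su))
    ... | no su≢u  = u , refl , su≢u ∘ sym
    w = proj₁ spare
    w∉image : ∀ a → w ≢ s a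
    w∉image a w≡sa = proj₂ (proj₂ spare) (trans w≡sa (cong s a≡fu))
      where a≡fu = trans (sym (f∘s a)) (trans (cong f (sym w≡sa)) (proj₁ (proj₂ spare)))
    extend : Fin (suc (size G')) → Fin (size G)
    extend zero    = w
    extend (suc a) = s a
    extend-injective : Injective _≡_ _≡_ extend
    extend-injective {zero}  {zero}  _ = refl
    extend-injective {zero}  {suc b} e = contradiction e (w∉image b)
    extend-injective {suc a} {zero}  e = contradiction (sym e) (w∉image a)
    extend-injective {suc a} {suc b} e = cong suc (s-injective e)

  contraction-MaxDegree≤ : ∀ {k} → MaxDegree≤ k G → MaxEdgeDegree≤ k G → MaxDegree≤ k G'
  contraction-MaxDegree≤ deg edgeDeg a (g , g-inj , a~g) = by-cases (f u ≟ a)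
    where
    preimage : ∀ i → a ≢ g i × ∃[ x ] ∃[ y ] (f x ≡ a × f y ≡ g i × adj G x y ≡ true)
    preimage i = Equivalence.to (adj' a (g i)) (a~g i)
    x y : Fin _ → Fin (size G)
    x i = proj₁ (proj₂ (preimage i))
    y i = proj₁ (proj₂ (proj₂ (preimage i)))
    fx≡a : ∀ i → f (x i) ≡ a
    fx≡a i = proj₁ (proj₂ (proj₂ (proj₂ (preimage i))))
    fy≡g : ∀ i → f (y i) ≡ g i
    fy≡g i = proj₁ (proj₂ (proj₂ (proj₂ (proj₂ (preimage i)))))
    x~y : ∀ i {z} → x i ≡ z → adj G z (y i) ≡ true
    x~y i refl = proj₂ (proj₂ (proj₂ (proj₂ (proj₂ (preimage i)))))
    y-injective : Injective _≡_ _≡_ y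
    y-injective {i} {j} e = g-inj (trans (sym (fy≡g i)) (trans (cong f e) (fy≡g j)))
    y∉fibre : ∀ i {z} → f z ≡ a → y i ≢ z
    y∉fibre i fz≡a refl = proj₁ (preimage i) (trans (sym fz≡a) (fy≡g i))
    by-cases : Dec (f u ≡ a) → ⊥
    by-cases (yes fu≡a) = edgeDeg u v edge (y , y-injective , λ i →
      y∉fibre i fu≡a , y∉fibre i (trans (sym merge) fu≡a) ,
      Sum.map (x~y i) (x~y i) (merged-fibre (trans (fx≡a i) (sym fu≡a))))
    by-cases (no fu≢a)  = deg (x zero) (y , y-injective , λ i →
      x~y i (fibre-injective (trans (fx≡a i) (sym (fx≡a zero)))
                             (λ fx≡fu → fu≢a (trans (sym fx≡fu) (fx≡a i)))))

≅-AtLeast : ∀ {H G k} (H≅G : H ≅ G) {x} → AtLeast k (λ y → adj H x y ≡ true) →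
            AtLeast k (λ y → adj G (Inverse.to (_≅_.bij H≅G) x) y ≡ true)
≅-AtLeast H≅G {x} (g , g-inj , x~g) =
  to ∘ g , g-inj ∘ Injection.injective (↔⇒↣ bij) , λ i → trans (sym (preserve x (g i))) (x~g i)
  where open _≅_ H≅G; open Inverse bij using (to)

≼⇒size≤ : ∀ {H G} → H ≼ G → size H ≤ size G
≼⇒size≤ (iso H≅G)       = injective⇒≤ (Injection.injective (↔⇒↣ (_≅_.bij H≅G)))
≼⇒size≤ (del _ _ _ H≼G) = ≼⇒size≤ H≼G
≼⇒size≤ (con _ _ c H≼G) = ≤-trans (≼⇒size≤ H≼G) (<⇒≤ (contraction-shrinks c))

module _ {H : Graph} {k : ℕ} {hub : Fin (size H)}
         (hub-degree : AtLeast (suc k) (λ y → adj H hub y ≡ true)) where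

  ¬≼-of-bounded-degree : ∀ {G} → size G ≤ size H → MaxDegree≤ k G → ¬ H ≼ G
  ¬≼-of-bounded-degree _ deg (iso H≅G) = deg _ (≅-AtLeast H≅G hub-degree)
  ¬≼-of-bounded-degree {G} G≤H deg (del _ _ _ H≼G) =
    ¬≼-of-bounded-degree G≤H (MaxDegree≤-deleteEdge G deg) H≼G
  ¬≼-of-bounded-degree G≤H _ (con _ _ c H≼G) =
    <⇒≱ (<-≤-trans (contraction-shrinks c) G≤H) (≼⇒size≤ H≼G)

  ¬≼-of-bounded-edge-degree : ∀ {G} → size G ≤ suc (size H) →
                              MaxDegree≤ k G → MaxEdgeDegree≤ k G → ¬ H ≼ G
  ¬≼-of-bounded-edge-degree _ deg _ (iso H≅G) = deg _ (≅-AtLeast H≅G hub-degree)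
  ¬≼-of-bounded-edge-degree {G} G≤1+H deg edgeDeg (del _ _ _ H≼G) =
    ¬≼-of-bounded-edge-degree G≤1+H (MaxDegree≤-deleteEdge G deg)
                                    (MaxEdgeDegree≤-deleteEdge G edgeDeg) H≼G
  ¬≼-of-bounded-edge-degree G≤1+H deg edgeDeg (con _ _ c H≼G) =
    ¬≼-of-bounded-degree (≤-pred (≤-trans (contraction-shrinks c) G≤1+H))
                         (contraction-MaxDegree≤ c deg edgeDeg) H≼G

_⇔-dec_ : ∀ {A B : Set} → Dec A → Dec B → Dec (A ⇔ B)
a? ⇔-dec b? = map′ (λ (to , from) → mk⇔ to from) (λ a⇔b → Equivalence.to a⇔b , Equivalence.from a⇔b)
                   ((a? →-dec b?) ×-dec (b? →-dec a?))

contraction-by-map : (G G' : Graph) (u v : Fin (size G)) (f : Fin (size G) → Fin (size G')) →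
  {_ : True (adjacent? G u v)} →
  {_ : True (all? λ a → any? λ x → f x ≟ a)} →
  {_ : True (f u ≟ f v)} →
  {_ : True (all? λ x → all? λ y → f x ≟ f y →-dec
              (x ≟ y ⊎-dec (x ≟ u ×-dec y ≟ v) ⊎-dec (x ≟ v ×-dec y ≟ u)))} →
  {_ : True (all? λ a → all? λ b → adjacent? G' a b ⇔-dec
              (¬? (a ≟ b) ×-dec any? λ x → any? λ y →
                 f x ≟ a ×-dec f y ≟ b ×-dec adjacent? G x y))} →
  Contraction G u v G'
contraction-by-map G G' u v f {e} {s} {m} {fib} {a} = record
  { edge = toWitness e ; f = f ; surj = toWitness s ; merge = toWitness m
  ; fibres = toWitness fib ; adj' = toWitness a }

-- Arc n x y: on the cycle 0, 1, …, n-1, the vertex y follows x at distance 1 or 2.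
-- Arc⁻ omits the arc from n-2 to 0.
data Arc⁻ : ℕ → ℕ → ℕ → Set where
  one   : ∀ {n x} → Arc⁻ n x (suc x)
  two   : ∀ {n x} → Arc⁻ n x (2 + x)
  wrap₀ : ∀ {x} → Arc⁻ (suc x) x 0
  wrap₁ : ∀ {x} → Arc⁻ (suc x) x 1

data Arc : ℕ → ℕ → ℕ → Set where
  arc⁻ : ∀ {n x y} → Arc⁻ n x y → Arc n x y
  wrap : ∀ {x} → Arc (2 + x) x 0

arc⁻? : ∀ n x y → Dec (Arc⁻ n x y)
arc⁻? n x y with y ≟ℕ suc x | y ≟ℕ 2 + x
... | yes refl | _        = yes one
... | no _     | yes refl = yes two
... | no ¬one  | no ¬two  with n ≟ℕ suc x | y
...   | yes refl | 0           = yes wrap₀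
...   | yes refl | 1           = yes wrap₁
...   | yes refl | suc (suc _) = no λ { one → ¬one refl ; two → ¬two refl }
...   | no ¬wrap | _           =
  no λ { one → ¬one refl ; two → ¬two refl ; wrap₀ → ¬wrap refl ; wrap₁ → ¬wrap refl }

C²⁻ : ℕ → Graph
C²⁻ n = mkGraph n (λ i j → ⌊ arc⁻? n (toℕ i) (toℕ j) ⌋)

adj-C²⁻ : ∀ {n} (i j : Fin n) →
          adj (C²⁻ n) i j ≡ true ⇔ (i ≢ j × (Arc⁻ n (toℕ i) (toℕ j) ⊎ Arc⁻ n (toℕ j) (toℕ i)))
adj-C²⁻ {n} = adj-mkGraph-dec (λ x y → arc⁻? n (toℕ x) (toℕ y))

C²-Step : ℕ → ℕ → ℕ → Set
C²-Step m x y = y ≡ (x + 1) % suc m ⊎ y ≡ (x + 2) % suc m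

adj-C² : ∀ m (i j : Fin (suc m)) → adj (C² (suc m)) i j ≡ true ⇔
         (i ≢ j × (C²-Step m (toℕ i) (toℕ j) ⊎ C²-Step m (toℕ j) (toℕ i)))
adj-C² m i j = (⇔-id _ ×-⇔ (step⇔ {toℕ i} {toℕ j} ⊎-⇔ step⇔ {toℕ j} {toℕ i})) ⇔-∘
               adj-mkGraph (λ x y → step (toℕ x) (toℕ y)) i j
  where
  step : ℕ → ℕ → Bool
  step x y = (y ≡ᵇ (x + 1) % suc m) ∨ (y ≡ᵇ (x + 2) % suc m)
  ≡ᵇ⇔ : ∀ {a b} → T (a ≡ᵇ b) ⇔ a ≡ b
  ≡ᵇ⇔ = mk⇔ (≡ᵇ⇒≡ _ _) (≡⇒≡ᵇ _ _)
  step⇔ : ∀ {x y} → step x y ≡ true ⇔ C²-Step m x y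
  step⇔ = (≡ᵇ⇔ ⊎-⇔ ≡ᵇ⇔) ⇔-∘ (Bool.T-∨ ⇔-∘ ⇔-sym Bool.T-≡)

C²-Step⇒Arc : ∀ {m x y} → 1 ≤ m → x < suc m → C²-Step m x y → Arc (suc m) x y
C²-Step⇒Arc {x = x} _ x<n (inj₁ refl) rewrite +-comm x 1 with m≤n⇒m<n∨m≡n x<n
... | inj₁ 1+x<n rewrite m<n⇒m%n≡m 1+x<n    = arc⁻ one
... | inj₂ refl  rewrite n%n≡0 (suc x) ⦃ _ ⦄ = arc⁻ wrap₀
C²-Step⇒Arc {x = x} 1≤m x<n (inj₂ refl) rewrite +-comm x 2 with m≤n⇒m<n∨m≡n (s≤s x<n)
... | inj₂ refl rewrite [m+n]%n≡m%n 1 (suc x) ⦃ _ ⦄ | m<n⇒m%n≡m (s≤s 1≤m) = arc⁻ wrap₁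
... | inj₁ (s≤s 2+x≤n) with m≤n⇒m<n∨m≡n 2+x≤n
...   | inj₁ 2+x<n rewrite m<n⇒m%n≡m 2+x<n    = arc⁻ two
...   | inj₂ refl  rewrite n%n≡0 (2 + x) ⦃ _ ⦄ = wrap

Arc⁻⇒C²-Step : ∀ {m x y} → 1 ≤ m → y < suc m → Arc⁻ (suc m) x y → C²-Step m x y
Arc⁻⇒C²-Step {x = x} _ y<n one   rewrite +-comm x 1 = inj₁ (sym (m<n⇒m%n≡m y<n))
Arc⁻⇒C²-Step {x = x} _ y<n two   rewrite +-comm x 2 = inj₂ (sym (m<n⇒m%n≡m y<n))
Arc⁻⇒C²-Step {x = x} _ _   wrap₀ rewrite +-comm x 1 = inj₁ (sym (n%n≡0 (suc x) ⦃ _ ⦄))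
Arc⁻⇒C²-Step {x = x} 1≤m _ wrap₁ rewrite +-comm x 2 | [m+n]%n≡m%n 1 (suc x) ⦃ _ ⦄ =
  inj₂ (sym (m<n⇒m%n≡m (s≤s 1≤m)))

adj-C²⇒Arc : ∀ m (i j : Fin (2 + m)) → adj (C² (2 + m)) i j ≡ true →
             Arc (2 + m) (toℕ i) (toℕ j) ⊎ Arc (2 + m) (toℕ j) (toℕ i)
adj-C²⇒Arc m i j ij = Sum.map (C²-Step⇒Arc (s≤s z≤n) (toℕ<n i)) (C²-Step⇒Arc (s≤s z≤n) (toℕ<n j))
                              (proj₂ (Equivalence.to (adj-C² (suc m) i j) ij))

C²⁻⊆C² : ∀ m (i j : Fin (2 + m)) → adj (C²⁻ (2 + m)) i j ≡ true → adj (C² (2 + m)) i j ≡ true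
C²⁻⊆C² m i j ij with Equivalence.to (adj-C²⁻ i j) ij
... | i≢j , arcs = Equivalence.from (adj-C² (suc m) i j)
  (i≢j , Sum.map (Arc⁻⇒C²-Step (s≤s z≤n) (toℕ<n j)) (Arc⁻⇒C²-Step (s≤s z≤n) (toℕ<n i)) arcs)

data Pinched (p : ℕ) : ℕ → ℕ → Set where
  below : ∀ {z} → z ≤ p → Pinched p z z
  top   : Pinched p (suc p) p

Pinched-suc : ∀ {p z w} → Pinched p z w → Pinched (suc p) (suc z) (suc w)
Pinched-suc (below z≤p) = below (s≤s z≤p)
Pinched-suc top         = top

toℕ-pinch : ∀ p (j : Fin (2 + p)) → Pinched p (toℕ j) (toℕ (pinch (fromℕ p) j))
toℕ-pinch zero    zero       = below z≤n
toℕ-pinch zero    (suc zero) = top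
toℕ-pinch (suc p) zero       = below z≤n
toℕ-pinch (suc p) (suc j)    = Pinched-suc (toℕ-pinch p j)

pinch-merges : ∀ {n} (i : Fin n) → pinch i (inject₁ i) ≡ pinch i (suc i)
pinch-merges zero    = refl
pinch-merges (suc i) = cong suc (pinch-merges i)

pinch-fibres : ∀ {n} (i : Fin n) (x y : Fin (suc n)) → pinch i x ≡ pinch i y →
               x ≡ y ⊎ (x ≡ inject₁ i × y ≡ suc i) ⊎ (x ≡ suc i × y ≡ inject₁ i)
pinch-fibres {suc _} _ zero zero _ = inj₁ refl
pinch-fibres zero    zero    (suc _) refl = inj₂ (inj₁ (refl , refl))
pinch-fibres zero    (suc _) zero    refl = inj₂ (inj₂ (refl , refl))
pinch-fibres zero    (suc _) (suc _) x≡y  = inj₁ (cong suc x≡y)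
pinch-fibres (suc i) (suc x) (suc y) e =
  Sum.map (cong suc) (Sum.map suc₂ suc₂) (pinch-fibres i x y (suc-injective e))
  where
  suc₂ : ∀ {m} {a b c d : Fin m} → a ≡ b × c ≡ d → Fin.suc a ≡ suc b × Fin.suc c ≡ suc d
  suc₂ = Product.map (cong suc) (cong suc)

pinch-inject₁ : ∀ p (a : Fin (suc p)) → pinch (fromℕ p) (inject₁ a) ≡ a
pinch-inject₁ zero    zero    = refl
pinch-inject₁ (suc p) zero    = refl
pinch-inject₁ (suc p) (suc a) = cong suc (pinch-inject₁ p a)

pinch-arc : ∀ {q x y a b} → 1 ≤ q → Pinched q x a → Pinched q y b → a ≢ b →
            Arc (2 + q) x y → Arc⁻ (suc q) a b
pinch-arc _  (below _)     (below _)     _   (arc⁻ one)   = one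
pinch-arc _  (below _)     top           a≢b (arc⁻ one)   = contradiction refl a≢b
pinch-arc _  top           (below 2+q≤q) _   (arc⁻ one)   = ⊥-elim (1+n≰n (≤-trans (n≤1+n _) 2+q≤q))
pinch-arc _  (below _)     (below _)     _   (arc⁻ two)   = two
pinch-arc _  (below _)     top           _   (arc⁻ two)   = one
pinch-arc _  top           (below 3+q≤q) _   (arc⁻ two)   =
  ⊥-elim (1+n≰n (≤-trans (n≤1+n _) (≤-trans (n≤1+n _) 3+q≤q)))
pinch-arc _  (below 1+q≤q) _             _   (arc⁻ wrap₀) = ⊥-elim (1+n≰n 1+q≤q)
pinch-arc _  top           (below _)     _   (arc⁻ wrap₀) = wrap₀
pinch-arc _  (below 1+q≤q) _             _   (arc⁻ wrap₁) = ⊥-elim (1+n≰n 1+q≤q)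
pinch-arc _  top           (below _)     _   (arc⁻ wrap₁) = wrap₁
pinch-arc () top           top           _   (arc⁻ wrap₁)
pinch-arc _  (below _)     (below _)     _   wrap         = wrap₀

pinch-last : ∀ p {a : Fin (suc p)} → toℕ a ≡ p → pinch (fromℕ p) (fromℕ (suc p)) ≡ a
pinch-last p {a} a≡p = begin
  pinch (fromℕ p) (fromℕ (suc p))     ≡⟨ sym (pinch-merges (fromℕ p)) ⟩
  pinch (fromℕ p) (inject₁ (fromℕ p)) ≡⟨ pinch-inject₁ p (fromℕ p) ⟩
  fromℕ p                             ≡⟨ toℕ-injective (trans (toℕ-fromℕ p) (sym a≡p)) ⟩
  a                                   ∎
  where open ≡-Reasoning

Arc⁻-from : ∀ {n x x' y} → x ≡ x' → Arc⁻ n x' y → Arc⁻ n x y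
Arc⁻-from refl x→y = x→y

lift-arc : ∀ p (a b : Fin (suc p)) → Arc⁻ (suc p) (toℕ a) (toℕ b) →
           ∃[ x ] pinch (fromℕ p) x ≡ a × Arc⁻ (2 + p) (toℕ x) (toℕ b)
lift-arc p a b a→b with toℕ a in a≡ | toℕ b | a→b
... | _ | _ | one   = inject₁ a , pinch-inject₁ p a , Arc⁻-from (trans (toℕ-inject₁ a) a≡) one
... | _ | _ | two   = inject₁ a , pinch-inject₁ p a , Arc⁻-from (trans (toℕ-inject₁ a) a≡) two
... | _ | _ | wrap₀ = fromℕ (suc p) , pinch-last p a≡ , Arc⁻-from (toℕ-fromℕ (suc p)) wrap₀
... | _ | _ | wrap₁ = fromℕ (suc p) , pinch-last p a≡ , Arc⁻-from (toℕ-fromℕ (suc p)) wrap₁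

contract-last-edge : ∀ p {R : Fin (3 + p) → Fin (3 + p) → Bool} →
  (∀ x y → adj (C²⁻ (3 + p)) x y ≡ true → adj (mkGraph (3 + p) R) x y ≡ true) →
  (∀ x y → adj (mkGraph (3 + p) R) x y ≡ true → adj (C² (3 + p)) x y ≡ true) →
  Contraction (mkGraph (3 + p) R) (inject₁ (fromℕ (suc p))) (fromℕ (2 + p)) (C²⁻ (2 + p))
contract-last-edge p {R} C²⁻⊆G G⊆C² = record
  { edge   = C²⁻⊆G u v (Equivalence.from (adj-C²⁻ u v) (u≢v , inj₁ u→v))
  ; f      = pinch q
  ; surj   = λ a → Product.map₂ (λ f∘x≡ → f∘x≡ refl) (pinch-surjective q a)
  ; merge  = pinch-merges q
  ; fibres = pinch-fibres q
  ; adj'   = λ a b → mk⇔ (lift a b) (project a b)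
  }
  where
  G = mkGraph (3 + p) R
  q = fromℕ (suc p)
  u = inject₁ q
  v = suc q
  u→v : Arc⁻ (3 + p) (toℕ u) (toℕ v)
  u→v rewrite toℕ-inject₁ q | toℕ-fromℕ (suc p) = one
  u≢v : u ≢ v
  u≢v u≡v = 1+n≢n (sym (trans (sym (toℕ-inject₁ q)) (cong toℕ u≡v)))
  Lifts : Fin (2 + p) → Fin (2 + p) → Set
  Lifts a b = ∃[ x ] ∃[ y ] (pinch q x ≡ a × pinch q y ≡ b × adj G x y ≡ true)
  lift-arc⁻ : ∀ a b → a ≢ b → Arc⁻ (2 + p) (toℕ a) (toℕ b) → Lifts a b
  lift-arc⁻ a b a≢b a→b with lift-arc (suc p) a b a→b
  ... | x , x↦a , x→b = x , inject₁ b , x↦a , y↦b ,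
    C²⁻⊆G x (inject₁ b) (Equivalence.from (adj-C²⁻ x (inject₁ b)) (x≢y , inj₁ x→y))
    where
    y↦b = pinch-inject₁ (suc p) b
    x→y = subst (Arc⁻ _ (toℕ x)) (sym (toℕ-inject₁ b)) x→b
    x≢y = λ x≡y → a≢b (trans (sym x↦a) (trans (cong (pinch q) x≡y) y↦b))
  Lifts-sym : ∀ {a b} → Lifts a b → Lifts b a
  Lifts-sym (x , y , x↦a , y↦b , xy) = y , x , y↦b , x↦a , trans (adj-sym G y x) xy
  lift : ∀ a b → adj (C²⁻ (2 + p)) a b ≡ true → a ≢ b × Lifts a b
  lift a b ab with Equivalence.to (adj-C²⁻ a b) ab
  ... | a≢b , inj₁ a→b = a≢b , lift-arc⁻ a b a≢b a→b
  ... | a≢b , inj₂ b→a = a≢b , Lifts-sym (lift-arc⁻ b a (a≢b ∘ sym) b→a)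
  project-arc : ∀ {x y a b} → pinch q x ≡ a → pinch q y ≡ b → a ≢ b →
                Arc (3 + p) (toℕ x) (toℕ y) → Arc⁻ (2 + p) (toℕ a) (toℕ b)
  project-arc {x} {y} refl refl a≢b =
    pinch-arc (s≤s z≤n) (toℕ-pinch (suc p) x) (toℕ-pinch (suc p) y) (a≢b ∘ toℕ-injective)
  project : ∀ a b → a ≢ b × Lifts a b → adj (C²⁻ (2 + p)) a b ≡ true
  project a b (a≢b , x , y , x↦a , y↦b , xy) = Equivalence.from (adj-C²⁻ a b) (a≢b ,
    Sum.map (project-arc x↦a y↦b a≢b) (project-arc y↦b x↦a (a≢b ∘ sym))
            (adj-C²⇒Arc (suc p) x y (G⊆C² x y xy)))

W₆-hub-degree : AtLeast 6 (λ y → adj W₆ zero y ≡ true)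
W₆-hub-degree = suc , suc-injective , toWitness {a? = all? (λ i → adjacent? W₆ zero (suc i))} _

W₆-free-by-counting : ∀ G →
  {_ : True (size G ≤? 8)} →
  {_ : True (all? λ x → count (adjacent? G x) ≤? 5)} →
  {_ : True (all? λ u → all? λ v → adjacent? G u v →-dec count (edgeNeighbour? G u v) ≤? 5)} →
  MinorFree W₆ G
W₆-free-by-counting G {size≤8} {degrees} {edgeDegrees} =
  ¬≼-of-bounded-edge-degree {hub = zero} W₆-hub-degree (toWitness size≤8)
    (maxDegree≤-by-count 5 G (toWitness degrees))
    (maxEdgeDegree≤-by-count 5 G (λ u v → toWitness edgeDegrees u v))

W₆-free-C² : ∀ {n} → n ≤ 8 → MinorFree W₆ (C² n)
W₆-free-C² {0} _ = W₆-free-by-counting (C² 0)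
W₆-free-C² {1} _ = W₆-free-by-counting (C² 1)
W₆-free-C² {2} _ = W₆-free-by-counting (C² 2)
W₆-free-C² {3} _ = W₆-free-by-counting (C² 3)
W₆-free-C² {4} _ = W₆-free-by-counting (C² 4)
W₆-free-C² {5} _ = W₆-free-by-counting (C² 5)
W₆-free-C² {6} _ = W₆-free-by-counting (C² 6)
W₆-free-C² {7} _ = W₆-free-by-counting (C² 7)
W₆-free-C² {8} _ = W₆-free-by-counting (C² 8)
W₆-free-C² {suc (suc (suc (suc (suc (suc (suc (suc (suc _))))))))}
  (s≤s (s≤s (s≤s (s≤s (s≤s (s≤s (s≤s (s≤s ()))))))))

fromEdges : (n : ℕ) → List (ℕ × ℕ) → Graph
fromEdges n es = mkGraph n (λ i j → any (λ (x , y) → (toℕ i ≡ᵇ x) ∧ (toℕ j ≡ᵇ y)) es)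

-- A W₆ model in C²_9 has hub branch set {1, 3, 5} and rim 0, 2, 4, 6, 7, 8.  Deleting the rim
-- chords {7, 0} (absent from C²⁻ 9) and {6, 8} and contracting {1, 3} leaves G₁, labelled by
-- merge-1-3; contracting the edge {1, 4} of G₁ (4 is the old 5) leaves W₆, labelled by merge-hub.
G₁ : Graph
G₁ = fromEdges 8 ((0 , 1) ∷ (0 , 2) ∷ (0 , 7) ∷ (1 , 2) ∷ (1 , 3) ∷ (1 , 4) ∷ (1 , 7) ∷ (2 , 3) ∷
                  (3 , 4) ∷ (3 , 5) ∷ (4 , 5) ∷ (4 , 6) ∷ (5 , 6) ∷ (6 , 7) ∷ [])

merge-1-3 : Fin 9 → Fin 8
merge-1-3 = lookup (# 0 ∷ # 1 ∷ # 2 ∷ # 1 ∷ # 3 ∷ # 4 ∷ # 5 ∷ # 6 ∷ # 7 ∷ [])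

merge-hub : Fin 8 → Fin 7
merge-hub = lookup (# 1 ∷ # 0 ∷ # 2 ∷ # 3 ∷ # 0 ∷ # 4 ∷ # 5 ∷ # 6 ∷ [])

W₆≼G₁ : W₆ ≼ G₁
W₆≼G₁ = con (# 1) (# 4) (contraction-by-map G₁ W₆ (# 1) (# 4) merge-hub) (iso ≅-refl)
  where ≅-refl = record { bij = ↔-id _ ; preserve = λ _ _ → refl }

W₆≼C²⁻9 : W₆ ≼ C²⁻ 9
W₆≼C²⁻9 = del (# 6) (# 8) refl
  (con (# 1) (# 3) (contraction-by-map _ G₁ (# 1) (# 3) merge-1-3) W₆≼G₁)

W₆≼C²9 : W₆ ≼ C² 9
W₆≼C²9 = del (# 7) (# 0) refl (del (# 6) (# 8) refl
  (con (# 1) (# 3) (contraction-by-map _ G₁ (# 1) (# 3) merge-1-3) W₆≼G₁))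

W₆≼C²⁻ : ∀ k → W₆ ≼ C²⁻ (9 + k)
W₆≼C²⁻ zero    = W₆≼C²⁻9
W₆≼C²⁻ (suc k) = con _ _ (contract-last-edge (7 + k) (λ _ _ xy → xy) (C²⁻⊆C² (8 + k))) (W₆≼C²⁻ k)

W₆≼C² : ∀ {n} → 9 ≤ n → W₆ ≼ C² n
W₆≼C² 9≤n with m≤n⇒∃[o]m+o≡n 9≤n
... | zero  , refl = W₆≼C²9
... | suc k , refl =
  con _ _ (contract-last-edge (7 + k) (C²⁻⊆C² (8 + k)) (λ _ _ xy → xy)) (W₆≼C²⁻ k)

-- The hypothesis 5 ≤ n only keeps C²_n the square of a cycle; the equivalence holds for every n.
lemma3p4 : ∀ (n : ℕ) → 5 ≤ n → (MinorFree W₆ (C² n) ⇔ (n ≤ 8))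
lemma3p4 n _ = mk⇔ (λ W₆-free → ≮⇒≥ (W₆-free ∘ W₆≼C²)) W₆-free-C²
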